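{- Let $W$ be a finite reflection group, $\gamma$ a Coxeter element of $W$ and $m\ge1$. If $(a_1,\ldots,a_m)\le(b_1,\ldots,b_m)$ in $NC_{(m)}(\gamma)$, then $(a_1^{ -1}b_1,\ldots,a_m^{ -1}b_m)\in NC_{(m)}(\gamma)$, and the intervals $[(a_1,\ldots,a_m),(b_1,\ldots,b_m)]$ and $[(\mathbf 1,\ldots,\mathbf 1),(a_1^{ -1}b_1,\ldots,a_m^{ -1}b_m)]$ of $NC_{(m)}(\gamma)$ are isomorphic posets.
   Context: $T$ is the set of reflections of $W$, $l_T(w)$ the smallest number of reflections with product $w$, and $u\le v$ iff $l_T(u)+l_T(u^{ -1}v)=l_T(v)$ (absolute order). $NC(\gamma)=\{w:\mathbf1\le w\le\gamma\}$. $NC_{(m)}(\gamma)$ is the set of $m$-tuples $(w_1,\dots,w_m)\in NC(\gamma)^m$ with $w_1\cdots w_m\le\gamma$ and $l_T(w_1\cdots w_m)=\sum_i l_T(w_i)$, partially ordered componentwise: $(u_1,\dots,u_m)\le(w_1,\dots,w_m)$ iff $u_i\le w_i$ for all $i$. -}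

module Defs where

open import Level using (Level; _⊔_)
open import Algebra.Bundles using (Group)
open import Algebra.Morphism.Structures using (module GroupMorphisms)
open import Data.Nat using (ℕ; zero; suc; _+_; _≤_)
open import Data.Fin using (Fin; zero; suc)
open import Data.Fin.Permutation using (Permutation′; _⟨$⟩ʳ_)
open import Data.List using (List; []; _∷_; length; map)
open import Data.List.Relation.Unary.All using (All)
open import Data.Product using (Σ; _×_; _,_; proj₁)
open import Relation.Nullary using (¬_)
open import Relation.Binary.PropositionalEquality using (_≡_)

pow : ∀ {c ℓ} (G : Group c ℓ) → Group.Carrier G → ℕ → Group.Carrier G
pow G x zero = Group.ε G
pow G x (suc k) = Group._∙_ G x (pow G x k)

sumF : (m : ℕ) → (Fin m → ℕ) → ℕ
sumF zero ns = 0
sumF (suc m) ns = ns zero + sumF m (λ i → ns (suc i))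

module _ {c ℓ : Level} (G : Group c ℓ) where
  open Group G

  prodL : List Carrier → Carrier
  prodL [] = ε
  prodL (x ∷ xs) = x ∙ prodL xs

  prodF : (m : ℕ) → (Fin m → Carrier) → Carrier
  prodF zero w = ε
  prodF (suc m) w = w zero ∙ prodF m (λ i → w (suc i))

  IsFinite : Set (c ⊔ ℓ)
  IsFinite = Σ ℕ λ n → Σ (Fin n → Carrier) λ f → ∀ w → Σ (Fin n) λ i → f i ≈ w

  -- (G, {s_0,...,s_{r-1}}) is a Coxeter system: G is generated by the distinct
  -- involutions s_i and is presented by the relations (s_i s_j)^{m_ij} = 1
  -- (universal property of the Coxeter presentation).
  record IsCoxeterSystem (r : ℕ) (s : Fin r → Carrier) : Set (Level.suc (c ⊔ ℓ)) where
    field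
      generates    : ∀ w → Σ (List (Fin r)) λ ws → prodL (map s ws) ≈ w
      involution   : ∀ i → s i ∙ s i ≈ ε
      nontrivial   : ∀ i → ¬ (s i ≈ ε)
      distinct     : ∀ i j → s i ≈ s j → i ≡ j
      presentation : (H : Group c ℓ) (f : Fin r → Group.Carrier H) →
        (∀ i j k → pow G (s i ∙ s j) k ≈ ε →
                   Group._≈_ H (pow H (Group._∙_ H (f i) (f j)) k) (Group.ε H)) →
        Σ (Carrier → Group.Carrier H) λ φ →
          GroupMorphisms.IsGroupHomomorphism (Group.rawGroup G) (Group.rawGroup H) φ ×
          (∀ i → Group._≈_ H (φ (s i)) (f i))

  module _ (r : ℕ) (s : Fin r → Carrier) where

    IsReflection : Carrier → Set (c ⊔ ℓ)
    IsReflection t = Σ Carrier λ w → Σ (Fin r) λ i → t ≈ (w ∙ s i) ∙ w ⁻¹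

    IsCoxeterElement : Carrier → Set (c ⊔ ℓ)
    IsCoxeterElement γ = Σ (Permutation′ r) λ π → Σ Carrier λ w →
      γ ≈ (w ∙ prodF r (λ i → s (π ⟨$⟩ʳ i))) ∙ w ⁻¹

    TLength : Carrier → ℕ → Set (c ⊔ ℓ)
    TLength w n =
      (Σ (List Carrier) λ ts → All IsReflection ts × length ts ≡ n × prodL ts ≈ w) ×
      (∀ ts → All IsReflection ts → prodL ts ≈ w → n ≤ length ts)

    AbsLe : Carrier → Carrier → Set (c ⊔ ℓ)
    AbsLe u v = Σ ℕ λ a → Σ ℕ λ b → Σ ℕ λ d →
      TLength u a × TLength (u ⁻¹ ∙ v) b × TLength v d × a + b ≡ d

    NC : Carrier → Carrier → Set (c ⊔ ℓ)
    NC γ w = AbsLe ε w × AbsLe w γ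

    NCm : (m : ℕ) → Carrier → (Fin m → Carrier) → Set (c ⊔ ℓ)
    NCm m γ w =
      (∀ i → NC γ (w i)) × AbsLe (prodF m w) γ ×
      (Σ (Fin m → ℕ) λ ns → (∀ i → TLength (w i) (ns i)) × TLength (prodF m w) (sumF m ns))

    TupLe : (m : ℕ) → (Fin m → Carrier) → (Fin m → Carrier) → Set (c ⊔ ℓ)
    TupLe m u w = ∀ i → AbsLe (u i) (w i)

    TupEq : (m : ℕ) → (Fin m → Carrier) → (Fin m → Carrier) → Set ℓ
    TupEq m u w = ∀ i → u i ≈ w i

    Interval : (m : ℕ) → Carrier → (Fin m → Carrier) → (Fin m → Carrier) → Set (c ⊔ ℓ)
    Interval m γ a b = Σ (Fin m → Carrier) λ x → NCm m γ x × TupLe m a x × TupLe m x b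

    record IntervalIso (m : ℕ) (γ : Carrier) (a b a' b' : Fin m → Carrier) : Set (c ⊔ ℓ) where
      field
        to        : Interval m γ a b → Interval m γ a' b'
        from      : Interval m γ a' b' → Interval m γ a b
        to-cong   : ∀ x y → TupEq m (proj₁ x) (proj₁ y) → TupEq m (proj₁ (to x)) (proj₁ (to y))
        from-cong : ∀ x y → TupEq m (proj₁ x) (proj₁ y) → TupEq m (proj₁ (from x)) (proj₁ (from y))
        to-from   : ∀ y → TupEq m (proj₁ (to (from y))) (proj₁ y)
        from-to   : ∀ x → TupEq m (proj₁ (from (to x))) (proj₁ x)
        to-mono   : ∀ x y → TupLe m (proj₁ x) (proj₁ y) → TupLe m (proj₁ (to x)) (proj₁ (to y))
        from-mono : ∀ x y → TupLe m (proj₁ x) (proj₁ y) → TupLe m (proj₁ (from x)) (proj₁ (from y))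

{-# OPTIONS --safe #-}
-- It makes l_T a class
-- function, so a factorization of y as x · (x⁻¹y), or as (x (x⁻¹y) x⁻¹) · x, in which the
-- lengths add up to l_T(y) is automatically minimal in both factors. The heart of the matter
-- is that the absolute order is compatible with length-additive products: if u ≤ w, U ≤ W and
-- l_T(wW) = l_T(w) + l_T(W), then
--   wW = (uU) · ((U⁻¹ (u⁻¹w) U) (U⁻¹W))
-- exhibits uU ≤ wW with l_T(uU) = l_T(u) + l_T(U). Hence NC_(m)(γ) is a lower set for the
-- componentwise order, and left translation x ↦ a⁻¹x, with inverse y ↦ ay, maps the interval
-- [a, b] isomorphically onto [1, a⁻¹b].
module Submission where

open import Defs
open import Level using (Level; _⊔_)
open import Algebra.Bundles using (Group)
open import Data.Nat using (ℕ; zero; suc; _+_; _≤_; z≤n)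
open import Data.Nat.Properties
  using (+-assoc; +-comm; +-cancelˡ-≤; ≤-antisym; +-commutativeSemigroup)
open import Algebra.Properties.CommutativeSemigroup +-commutativeSemigroup using (interchange)
open import Data.Fin using (Fin; zero; suc)
open import Data.List using (List; []; _∷_; length; map; _++_)
open import Data.List.Properties using (length-++; length-map)
open import Data.List.Relation.Unary.All as All using (All; [])
open import Data.List.Relation.Unary.All.Properties using (++⁺; map⁺)
open import Data.Product using (Σ-syntax; _×_; _,_; proj₁; proj₂)
open import Relation.Binary.PropositionalEquality as ≡ using (_≡_; refl; subst)

module AbsoluteOrder {c ℓ : Level} (G : Group c ℓ) (r : ℕ) (s : Fin r → Group.Carrier G) where
  open Group G renaming (refl to ≈-refl; sym to ≈-sym; trans to ≈-trans)
  open import Algebra.Properties.Group G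
    using (⁻¹-anti-homo-∙; ⁻¹-anti-homo-\\; ⁻¹-involutive; ε⁻¹≈ε;
           \\-leftDividesˡ; \\-leftDividesʳ; //-rightDividesˡ)
  open import Relation.Binary.Reasoning.Setoid setoid

  Reflection : Carrier → Set (c ⊔ ℓ)
  Reflection = IsReflection G r s

  Len : Carrier → ℕ → Set (c ⊔ ℓ)
  Len = TLength G r s

  infix 4 _⊑_
  _⊑_ : Carrier → Carrier → Set (c ⊔ ℓ)
  _⊑_ = AbsLe G r s

  Factorization : Carrier → ℕ → Set (c ⊔ ℓ)
  Factorization x n = Σ[ ts ∈ List Carrier ] All Reflection ts × length ts ≡ n × prodL G ts ≈ x

  LengthAdditive : (m : ℕ) → (Fin m → Carrier) → Set (c ⊔ ℓ)
  LengthAdditive m w =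
    Σ[ ns ∈ (Fin m → ℕ) ] (∀ i → Len (w i) (ns i)) × Len (prodF G m w) (sumF m ns)

  conj : Carrier → Carrier → Carrier
  conj g x = g ∙ x ∙ g ⁻¹

  x⁻¹y∙y⁻¹z≈x⁻¹z : ∀ x y z → (x ⁻¹ ∙ y) ∙ (y ⁻¹ ∙ z) ≈ x ⁻¹ ∙ z
  x⁻¹y∙y⁻¹z≈x⁻¹z x y z = ≈-trans (assoc (x ⁻¹) y (y ⁻¹ ∙ z)) (∙-congˡ (\\-leftDividesˡ y z))

  conj-cong : ∀ g {x y} → x ≈ y → conj g x ≈ conj g y
  conj-cong g x≈y = ∙-congʳ (∙-congˡ x≈y)

  conj-ε : ∀ g → conj g ε ≈ ε
  conj-ε g = ≈-trans (∙-congʳ (identityʳ g)) (inverseʳ g)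

  conj-∙ : ∀ g x y → conj g x ∙ conj g y ≈ conj g (x ∙ y)
  conj-∙ g x y = begin
    g ∙ x ∙ g ⁻¹ ∙ (g ∙ y ∙ g ⁻¹)    ≈⟨ assoc (g ∙ x) (g ⁻¹) (g ∙ y ∙ g ⁻¹) ⟩
    g ∙ x ∙ (g ⁻¹ ∙ (g ∙ y ∙ g ⁻¹))  ≈⟨ ∙-congˡ (assoc (g ⁻¹) (g ∙ y) (g ⁻¹)) ⟨
    g ∙ x ∙ (g ⁻¹ ∙ (g ∙ y) ∙ g ⁻¹)  ≈⟨ ∙-congˡ (∙-congʳ (\\-leftDividesʳ g y)) ⟩
    g ∙ x ∙ (y ∙ g ⁻¹)              ≈⟨ assoc (g ∙ x) y (g ⁻¹) ⟨
    g ∙ x ∙ y ∙ g ⁻¹                ≈⟨ ∙-congʳ (assoc g x y) ⟩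
    g ∙ (x ∙ y) ∙ g ⁻¹              ∎

  conj-conj : ∀ g h x → conj g (conj h x) ≈ conj (g ∙ h) x
  conj-conj g h x = begin
    g ∙ (h ∙ x ∙ h ⁻¹) ∙ g ⁻¹    ≈⟨ ∙-congʳ (assoc g (h ∙ x) (h ⁻¹)) ⟨
    g ∙ (h ∙ x) ∙ h ⁻¹ ∙ g ⁻¹    ≈⟨ assoc (g ∙ (h ∙ x)) (h ⁻¹) (g ⁻¹) ⟩
    g ∙ (h ∙ x) ∙ (h ⁻¹ ∙ g ⁻¹)  ≈⟨ ∙-cong (assoc g h x) (⁻¹-anti-homo-∙ g h) ⟨
    g ∙ h ∙ x ∙ (g ∙ h) ⁻¹       ∎

  conj⁻¹-conj : ∀ g x → conj (g ⁻¹) (conj g x) ≈ x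
  conj⁻¹-conj g x = begin
    g ⁻¹ ∙ (g ∙ x ∙ g ⁻¹) ∙ g ⁻¹ ⁻¹  ≈⟨ ∙-cong (∙-congˡ (assoc g x (g ⁻¹))) (⁻¹-involutive g) ⟩
    g ⁻¹ ∙ (g ∙ (x ∙ g ⁻¹)) ∙ g     ≈⟨ ∙-congʳ (\\-leftDividesʳ g (x ∙ g ⁻¹)) ⟩
    x ∙ g ⁻¹ ∙ g                   ≈⟨ //-rightDividesˡ g x ⟩
    x                              ∎

  prodL-++ : ∀ xs ys → prodL G (xs ++ ys) ≈ prodL G xs ∙ prodL G ys
  prodL-++ []       ys = ≈-sym (identityˡ (prodL G ys))
  prodL-++ (x ∷ xs) ys = ≈-trans (∙-congˡ (prodL-++ xs ys)) (≈-sym (assoc x (prodL G xs) (prodL G ys)))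

  prodL-map-conj : ∀ g xs → prodL G (map (conj g) xs) ≈ conj g (prodL G xs)
  prodL-map-conj g []       = ≈-sym (conj-ε g)
  prodL-map-conj g (x ∷ xs) = ≈-trans (∙-congˡ (prodL-map-conj g xs)) (conj-∙ g x (prodL G xs))

  reflection-conj : ∀ g {t} → Reflection t → Reflection (conj g t)
  reflection-conj g (w , i , t≈) = g ∙ w , i , ≈-trans (conj-cong g t≈) (conj-conj g w (s i))

  factorization-resp : ∀ {x y n} → x ≈ y → Factorization x n → Factorization y n
  factorization-resp x≈y (ts , ts∈T , len , ts≈x) = ts , ts∈T , len , ≈-trans ts≈x x≈y

  factorization-ε : Factorization ε 0
  factorization-ε = [] , [] , refl , ≈-refl

  factorization-∙ : ∀ {x y m n} → Factorization x m → Factorization y n → Factorization (x ∙ y) (m + n)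
  factorization-∙ (xs , xs∈T , refl , xs≈x) (ys , ys∈T , refl , ys≈y) =
    xs ++ ys , ++⁺ xs∈T ys∈T , length-++ xs , ≈-trans (prodL-++ xs ys) (∙-cong xs≈x ys≈y)

  factorization-conj : ∀ g {x n} → Factorization x n → Factorization (conj g x) n
  factorization-conj g (ts , ts∈T , refl , ts≈x) =
    map (conj g) ts , map⁺ (All.map (reflection-conj g) ts∈T) , length-map (conj g) ts ,
    ≈-trans (prodL-map-conj g ts) (conj-cong g ts≈x)

  factorization-prodF : ∀ m {w : Fin m → Carrier} {ns : Fin m → ℕ} →
    (∀ i → Factorization (w i) (ns i)) → Factorization (prodF G m w) (sumF m ns)
  factorization-prodF zero    _ = factorization-ε
  factorization-prodF (suc m) f = factorization-∙ (f zero) (factorization-prodF m (λ i → f (suc i)))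

  len-minimal : ∀ {x n k} → Len x n → Factorization x k → n ≤ k
  len-minimal (_ , minimal) (ts , ts∈T , refl , ts≈x) = minimal ts ts∈T ts≈x

  len-unique : ∀ {x m n} → Len x m → Len x n → m ≡ n
  len-unique lm ln = ≤-antisym (len-minimal lm (proj₁ ln)) (len-minimal ln (proj₁ lm))

  len-resp : ∀ {x y n} → x ≈ y → Len x n → Len y n
  len-resp x≈y (f , minimal) =
    factorization-resp x≈y f , λ ts ts∈T ts≈y → minimal ts ts∈T (≈-trans ts≈y (≈-sym x≈y))

  len-ε : Len ε 0
  len-ε = factorization-ε , λ _ _ _ → z≤n

  len-via-extension : ∀ {x y p n} → Len y (p + n) → Factorization x n →
    (∀ {k} → Factorization x k → Factorization y (p + k)) → Len x n
  len-via-extension {p = p} {n} ly fx extend = fx , λ ts ts∈T ts≈x →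
    +-cancelˡ-≤ p n (length ts) (len-minimal ly (extend (ts , ts∈T , refl , ts≈x)))

  len-conj : ∀ g {x n} → Len x n → Len (conj g x) n
  len-conj g {x} lx = len-via-extension {p = 0} lx (factorization-conj g (proj₁ lx))
    (λ f → factorization-resp (conj⁻¹-conj g x) (factorization-conj (g ⁻¹) f))

  len-split : ∀ {x y m n} → Factorization x m → Factorization (x ⁻¹ ∙ y) n → Len y (m + n) →
    Len x m × Len (x ⁻¹ ∙ y) n
  len-split {x} {y} {m} {n} fx fq ly =
    len-via-extension (subst (Len y) (+-comm m n) ly) fx
      (λ f → factorization-resp conj∙x≈y (factorization-∙ (factorization-conj x fq) f)) ,
    len-via-extension ly fq (λ f → factorization-resp (\\-leftDividesˡ x y) (factorization-∙ fx f))
    where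
    conj∙x≈y : conj x (x ⁻¹ ∙ y) ∙ x ≈ y
    conj∙x≈y = ≈-trans (∙-congʳ (∙-congʳ (\\-leftDividesˡ x y))) (//-rightDividesˡ x y)

  ⊑-intro : ∀ {u v a b} → Len u a → Len (u ⁻¹ ∙ v) b → Len v (a + b) → u ⊑ v
  ⊑-intro {a = a} {b} lu lq lv = a , b , a + b , lu , lq , lv , refl

  ⊑-view : ∀ {u w α} → Len u α → u ⊑ w → Σ[ β ∈ ℕ ] Len (u ⁻¹ ∙ w) β × Len w (α + β)
  ⊑-view {w = w} lu (_ , β , _ , lu′ , lq , lw , refl) =
    β , lq , subst (λ α → Len w (α + β)) (len-unique lu′ lu) lw

  ⊑-respʳ : ∀ {u v v′} → v ≈ v′ → u ⊑ v → u ⊑ v′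
  ⊑-respʳ v≈v′ (a , b , d , lu , lq , lv , a+b≡d) =
    a , b , d , lu , len-resp (∙-congˡ v≈v′) lq , len-resp v≈v′ lv , a+b≡d

  ε⊑ : ∀ {y n} → Len y n → ε ⊑ y
  ε⊑ {y} ly = ⊑-intro len-ε (len-resp (≈-sym (≈-trans (∙-congʳ ε⁻¹≈ε) (identityˡ y))) ly) ly

  len-quotient-chain : ∀ {a x b α p q} → Len a α → Len (a ⁻¹ ∙ x) p → Len (x ⁻¹ ∙ b) q →
    Len b (α + (p + q)) → Len (a ⁻¹ ∙ b) (p + q)
  len-quotient-chain {a} {x} {b} la lax lxb lb = proj₂ (len-split (proj₁ la) fab lb)
    where
    fab : Factorization (a ⁻¹ ∙ b) _
    fab = factorization-resp (x⁻¹y∙y⁻¹z≈x⁻¹z a x b) (factorization-∙ (proj₁ lax) (proj₁ lxb))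

  ⊑-trans : ∀ {a x b} → a ⊑ x → x ⊑ b → a ⊑ b
  ⊑-trans {b = b} (α , p , _ , la , lax , lx , refl) x⊑b with ⊑-view lx x⊑b
  ... | q , lxb , lb = ⊑-intro la (len-quotient-chain la lax lxb lb′) lb′
    where
    lb′ : Len b (α + (p + q))
    lb′ = subst (Len b) (+-assoc α p q) lb

  ⊑⇒⁻¹∙⊑ : ∀ {u v} → u ⊑ v → u ⁻¹ ∙ v ⊑ v
  ⊑⇒⁻¹∙⊑ {u} {v} (a , b , _ , lu , lq , lv , refl) =
    ⊑-intro lq (len-resp conj≈quotient (len-conj (v ⁻¹) lu)) (subst (Len v) (+-comm a b) lv)
    where
    conj≈quotient : conj (v ⁻¹) u ≈ (u ⁻¹ ∙ v) ⁻¹ ∙ v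
    conj≈quotient = ∙-cong (≈-sym (⁻¹-anti-homo-\\ u v)) (⁻¹-involutive v)

  ⁻¹∙-mono-⊑ : ∀ {a x b} → a ⊑ x → x ⊑ b → a ⁻¹ ∙ x ⊑ a ⁻¹ ∙ b
  ⁻¹∙-mono-⊑ {a} {x} {b} (α , p , _ , la , lax , lx , refl) x⊑b with ⊑-view lx x⊑b
  ... | q , lxb , lb =
    ⊑-intro lax (len-resp quotient≈ lxb) (len-quotient-chain la lax lxb (subst (Len b) (+-assoc α p q) lb))
    where
    quotient≈ : x ⁻¹ ∙ b ≈ (a ⁻¹ ∙ x) ⁻¹ ∙ (a ⁻¹ ∙ b)
    quotient≈ = ≈-trans (≈-sym (x⁻¹y∙y⁻¹z≈x⁻¹z x a b)) (∙-congʳ (≈-sym (⁻¹-anti-homo-\\ a x)))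

  ∙-between : ∀ {a b y} → a ⊑ b → y ⊑ a ⁻¹ ∙ b → a ⊑ a ∙ y × a ∙ y ⊑ b
  ∙-between {a} {b} {y} (α , β , _ , la , lab , lb , refl) (p , q , _ , ly , lq , lab′ , refl) =
    ⊑-intro la (len-resp (≈-sym (\\-leftDividesʳ a y)) ly) (proj₁ split) ,
    ⊑-intro (proj₁ split) (proj₂ split) lb′
    where
    lb′ : Len b (α + p + q)
    lb′ = subst (Len b) (≡.trans (≡.cong (α +_) (len-unique lab lab′)) (≡.sym (+-assoc α p q))) lb
    quotient≈ : y ⁻¹ ∙ (a ⁻¹ ∙ b) ≈ (a ∙ y) ⁻¹ ∙ b
    quotient≈ = ≈-trans (≈-sym (assoc (y ⁻¹) (a ⁻¹) b)) (∙-congʳ (≈-sym (⁻¹-anti-homo-∙ a y)))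
    split : Len (a ∙ y) (α + p) × Len ((a ∙ y) ⁻¹ ∙ b) q
    split = len-split (factorization-∙ (proj₁ la) (proj₁ ly)) (factorization-resp quotient≈ (proj₁ lq)) lb′

  ∙-mono-⊑ : ∀ {a b y y′} → a ⊑ b → y ⊑ y′ → y′ ⊑ a ⁻¹ ∙ b → a ∙ y ⊑ a ∙ y′
  ∙-mono-⊑ {a} {y′ = y′} a⊑b y⊑y′ y′⊑a⁻¹b =
    proj₂ (∙-between (proj₁ (∙-between a⊑b y′⊑a⁻¹b)) (⊑-respʳ (≈-sym (\\-leftDividesʳ a y′)) y⊑y′))

  ⊑-∙ : ∀ {u U w W α α′ D D′} → Len u α → Len U α′ → Len w D → Len W D′ → Len (w ∙ W) (D + D′) →
    u ⊑ w → U ⊑ W → Len (u ∙ U) (α + α′) × u ∙ U ⊑ w ∙ W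
  ⊑-∙ {u} {U} {w} {W} {α} {α′} lu lU lw lW lwW u⊑w U⊑W
    with ⊑-view lu u⊑w | ⊑-view lU U⊑W
  ... | β , luw , lw′ | β′ , lUW , lW′ = proj₁ split , ⊑-intro (proj₁ split) (proj₂ split) lwW′
    where
    lwW′ : Len (w ∙ W) (α + α′ + (β + β′))
    lwW′ = subst (Len (w ∙ W))
      (≡.trans (≡.cong₂ _+_ (len-unique lw lw′) (len-unique lW lW′)) (interchange α β α′ β′)) lwW
    cofactor≈ : conj (U ⁻¹) (u ⁻¹ ∙ w) ∙ (U ⁻¹ ∙ W) ≈ (u ∙ U) ⁻¹ ∙ (w ∙ W)
    cofactor≈ = begin
      U ⁻¹ ∙ (u ⁻¹ ∙ w) ∙ U ⁻¹ ⁻¹ ∙ (U ⁻¹ ∙ W)  ≈⟨ ∙-congʳ (∙-congˡ (⁻¹-involutive U)) ⟩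
      U ⁻¹ ∙ (u ⁻¹ ∙ w) ∙ U ∙ (U ⁻¹ ∙ W)       ≈⟨ assoc (U ⁻¹ ∙ (u ⁻¹ ∙ w)) U (U ⁻¹ ∙ W) ⟩
      U ⁻¹ ∙ (u ⁻¹ ∙ w) ∙ (U ∙ (U ⁻¹ ∙ W))     ≈⟨ ∙-congˡ (\\-leftDividesˡ U W) ⟩
      U ⁻¹ ∙ (u ⁻¹ ∙ w) ∙ W                   ≈⟨ ∙-congʳ (assoc (U ⁻¹) (u ⁻¹) w) ⟨
      U ⁻¹ ∙ u ⁻¹ ∙ w ∙ W                     ≈⟨ ∙-congʳ (∙-congʳ (⁻¹-anti-homo-∙ u U)) ⟨
      (u ∙ U) ⁻¹ ∙ w ∙ W                      ≈⟨ assoc ((u ∙ U) ⁻¹) w W ⟩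
      (u ∙ U) ⁻¹ ∙ (w ∙ W)                    ∎
    split : Len (u ∙ U) (α + α′) × Len ((u ∙ U) ⁻¹ ∙ (w ∙ W)) (β + β′)
    split = len-split (factorization-∙ (proj₁ lu) (proj₁ lU))
      (factorization-resp cofactor≈ (factorization-∙ (factorization-conj (U ⁻¹) (proj₁ luw)) (proj₁ lUW)))
      lwW′

  len-prodF-tail : ∀ m {w : Fin (suc m) → Carrier} {ns : Fin (suc m) → ℕ} →
    (∀ i → Len (w i) (ns i)) → Len (prodF G (suc m) w) (sumF (suc m) ns) →
    Len (prodF G m (λ i → w (suc i))) (sumF m (λ i → ns (suc i)))
  len-prodF-tail m {w} lw lΠ =
    len-resp (\\-leftDividesʳ (w zero) Π) (proj₂ (len-split (proj₁ (lw zero)) fΠ lΠ))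
    where
    Π : Carrier
    Π = prodF G m (λ i → w (suc i))
    fΠ : Factorization (w zero ⁻¹ ∙ (w zero ∙ Π)) _
    fΠ = factorization-resp (≈-sym (\\-leftDividesʳ (w zero) Π))
      (factorization-prodF m (λ i → proj₁ (lw (suc i))))

  prodF-⊑ : ∀ m {u w : Fin m → Carrier} → LengthAdditive m w → (∀ i → u i ⊑ w i) →
    LengthAdditive m u × prodF G m u ⊑ prodF G m w
  prodF-⊑ zero    _ _ = ((λ ()) , (λ ()) , len-ε) , ε⊑ len-ε
  prodF-⊑ (suc m) (ns , lw , lΠ) u⊑w
    with u⊑w zero | prodF-⊑ m (_ , (λ i → lw (suc i)) , len-prodF-tail m lw lΠ) (λ i → u⊑w (suc i))
  ... | α , _ , _ , lu₀ , _ | (ms , lus , luΠ) , uΠ⊑wΠ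
    with ⊑-∙ lu₀ luΠ (lw zero) (len-prodF-tail m lw lΠ) lΠ (u⊑w zero) uΠ⊑wΠ
  ... | lu , u⊑w′ =
    ((λ { zero → α ; (suc i) → ms i }) , (λ { zero → lu₀ ; (suc i) → lus i }) , lu) , u⊑w′

  NCm-⊑-closed : ∀ {m γ w u} → NCm G r s m γ w → (∀ i → u i ⊑ w i) → NCm G r s m γ u
  NCm-⊑-closed {m} (w∈NC , wΠ⊑γ , w-add) u⊑w with prodF-⊑ m w-add u⊑w
  ... | u-add@(_ , lu , _) , uΠ⊑wΠ =
    (λ i → ε⊑ (lu i) , ⊑-trans (u⊑w i) (proj₂ (w∈NC i))) , ⊑-trans uΠ⊑wΠ wΠ⊑γ , u-add

  quotient-interval : ∀ {m γ a b} →
    Interval G r s m γ a b → Interval G r s m γ (λ _ → ε) (λ i → a i ⁻¹ ∙ b i)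
  quotient-interval {m} {γ} {a} (x , x∈NC , a⊑x , x⊑b) =
    (λ i → a i ⁻¹ ∙ x i) , y∈NC , (λ i → proj₁ (proj₁ y∈NC i)) , (λ i → ⁻¹∙-mono-⊑ (a⊑x i) (x⊑b i))
    where
    y∈NC : NCm G r s m γ (λ i → a i ⁻¹ ∙ x i)
    y∈NC = NCm-⊑-closed x∈NC (λ i → ⊑⇒⁻¹∙⊑ (a⊑x i))

  product-interval : ∀ {m γ a b} → NCm G r s m γ b → (∀ i → a i ⊑ b i) →
    Interval G r s m γ (λ _ → ε) (λ i → a i ⁻¹ ∙ b i) → Interval G r s m γ a b
  product-interval {a = a} {b} b∈NC a⊑b (y , _ , _ , y⊑a⁻¹b) =
    (λ i → a i ∙ y i) , NCm-⊑-closed b∈NC (λ i → proj₂ (between i)) ,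
    (λ i → proj₁ (between i)) , (λ i → proj₂ (between i))
    where
    between : ∀ i → a i ⊑ a i ∙ y i × a i ∙ y i ⊑ b i
    between i = ∙-between (a⊑b i) (y⊑a⁻¹b i)

lemma5p3 : ∀ {c ℓ : Level} (W : Group c ℓ) (r : ℕ) (s : Fin r → Group.Carrier W) →
    IsFinite W → IsCoxeterSystem W r s →
    (γ : Group.Carrier W) → IsCoxeterElement W r s γ →
    (m : ℕ) → 1 ≤ m →
    (a b : Fin m → Group.Carrier W) →
    NCm W r s m γ a → NCm W r s m γ b → TupLe W r s m a b →
    NCm W r s m γ (λ i → Group._∙_ W (Group._⁻¹ W (a i)) (b i)) ×
    IntervalIso W r s m γ a b (λ i → Group.ε W) (λ i → Group._∙_ W (Group._⁻¹ W (a i)) (b i))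
lemma5p3 W r s _ _ γ _ m _ a b _ b∈NC a⊑b = NCm-⊑-closed b∈NC (λ i → ⊑⇒⁻¹∙⊑ (a⊑b i)) , iso
  where
  open Group W
  open AbsoluteOrder W r s
  open import Algebra.Properties.Group W using (\\-leftDividesˡ; \\-leftDividesʳ)
  iso : IntervalIso W r s m γ a b (λ _ → ε) (λ i → a i ⁻¹ ∙ b i)
  iso = record
    { to        = quotient-interval
    ; from      = product-interval b∈NC a⊑b
    ; to-cong   = λ _ _ x≈x′ i → ∙-congˡ (x≈x′ i)
    ; from-cong = λ _ _ y≈y′ i → ∙-congˡ (y≈y′ i)
    ; to-from   = λ y i → \\-leftDividesʳ (a i) (proj₁ y i)
    ; from-to   = λ x i → \\-leftDividesˡ (a i) (proj₁ x i)
    ; to-mono   = λ (_ , _ , a⊑x , _) _ x⊑x′ i → ⁻¹∙-mono-⊑ (a⊑x i) (x⊑x′ i)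
    ; from-mono = λ _ (_ , _ , _ , y′⊑) y⊑y′ i → ∙-mono-⊑ (a⊑b i) (y⊑y′ i) (y′⊑ i)
    }
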